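{- Let $X=\{a_1,\dots,a_{3n}\}$ be a set of distinct natural numbers with $\sum_{i=1}^{3n}a_i=nB$ and $B/4<a_i<B/2$ for all $i$, let $m=\max X$, and let $G_p$ be the graph constructed from $X$ as described in the context. If $X$ can be partitioned into $n$ triples each of which sums to $B$, then $b(G_p)=2m+1$.
   Context: Burning: for a finite simple graph $G$, a burning sequence is a sequence $(b_1,\dots,b_k)$ of vertices such that every vertex $v$ satisfies $d_G(v,b_i)\le k-i$ for some $i$; $b(G)$ is the minimum length of a burning sequence. Construction of $G_p$ from $X$: let $k=m-3n$, $X'=\{2a_i-1: a_i\in X\}$, $B'=\frac{1}{n}\sum_{x\in X'}x$, $Z=\{1,3,5,\dots,2m-1\}$ (the first $m$ odd naturals), and $Y=Z\setminus X'$, so $|Y|=k$; let $y_i$ be the $i$-th largest element of $Y$. Take paths $S_1,\dots,S_n$ each on $B'$ vertices, paths $S'_1,\dots,S'_k$ with $S'_i$ on $y_i$ vertices, and paths $Q_1,\dots,Q_{m+1}$ with $Q_j$ on $2(2m+1-j)+1$ vertices. Concatenate them (joining the last vertex of each path by an edge to the first vertex of the next) in the order $S_1,Q_1,S_2,Q_2,\dots,S_n,Q_n,S'_1,Q_{n+1},S'_2,Q_{n+2},\dots,S'_k,Q_{n+k},Q_{n+k+1},\dots,Q_{m+1}$, giving a path $P$ on $(2m+1)^2$ vertices. Then for each $Q_i$ with vertices $w_1,\dots,w_{s}$ in path order ($s=|V(Q_i)|$), add $s-1$ new vertices $q_{i1},\dots,q_{i(s-1)}$ where $q_{ix}$ is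 adjacent exactly to $w_x$ and $w_{x+1}$. The resulting graph is $G_p$ (a connected proper interval graph). -}

module Defs where

open import Data.Nat using (ℕ; zero; suc; _+_; _*_; _∸_; _≤_; _<_; _⊔_; NonZero)
open import Data.Nat.DivMod using (_/_)
open import Data.Nat.Properties using (_≟_)
open import Data.Fin using (Fin; toℕ)
open import Data.Nat.ListAction using (sum)
open import Data.List using (List; []; _∷_; map; foldr; upTo; allFin; filter; reverse; concat; concatMap; zipWith; _++_)
open import Data.List.Membership.Propositional using (_∈_)
open import Data.List.Membership.DecPropositional _≟_ using (_∈?_)
open import Data.Maybe using (Maybe; just; nothing)
open import Data.Product using (Σ; ∃; ∃-syntax; _×_; _,_; proj₁)
open import Relation.Nullary using (¬?)
open import Relation.Binary.PropositionalEquality using (_≡_)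
open import Function.Definitions using (Bijective)

record Graph : Set₁ where
  field
    V   : Set
    Adj : V → V → Set

open Graph public

data Dist≤ (G : Graph) : ℕ → V G → V G → Set where
  here : ∀ {r u} → Dist≤ G r u u
  step : ∀ {r u w v} → Adj G u w → Dist≤ G r w v → Dist≤ G (suc r) u v

-- (b_1,…,b_k) given as b : Fin k → V (b (i) is b_{i+1});
-- every vertex v has d(v, b_{i}) ≤ k - i for some i  (1-based i)
IsBurningSeq : (G : Graph) (k : ℕ) → (Fin k → V G) → Set
IsBurningSeq G k b = ∀ (v : V G) → ∃[ i ] Dist≤ G (k ∸ suc (toℕ i)) v (b i)

BurningNumber : Graph → ℕ → Set
BurningNumber G k =
  Σ (Fin k → V G) (IsBurningSeq G k) ×
  (∀ (j : ℕ) (b : Fin j → V G) → IsBurningSeq G j b → k ≤ j)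

Xlist : (n : ℕ) → (Fin (3 * n) → ℕ) → List ℕ
Xlist n a = map a (allFin (3 * n))

maxX : (n : ℕ) → (Fin (3 * n) → ℕ) → ℕ
maxX n a = foldr _⊔_ 0 (Xlist n a)

ThreePartition : (n B : ℕ) → (Fin (3 * n) → ℕ) → Set
ThreePartition n B a =
  Σ (Fin n × Fin 3 → Fin (3 * n)) λ σ →
    Bijective _≡_ _≡_ σ ×
    (∀ i → a (σ (i , Fin.zero)) + a (σ (i , Fin.suc Fin.zero))
             + a (σ (i , Fin.suc (Fin.suc Fin.zero))) ≡ B)

-- a path segment: its number of vertices, and `just j` if it is Q_j
Seg : Set
Seg = ℕ × Maybe ℕ

-- vertices of G_p: pv p = p-th vertex of P (0-based);
-- qv j x = the extra vertex q_{jx}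
data GV : Set where
  pv : ℕ → GV
  qv : ℕ → ℕ → GV

-- list of (j , offset of first vertex of Q_j in P , |V(Q_j)|)
layout : ℕ → List Seg → List (ℕ × ℕ × ℕ)
layout pos [] = []
layout pos ((s , nothing) ∷ r) = layout (pos + s) r
layout pos ((s , just j) ∷ r) = (j , pos , s) ∷ layout (pos + s) r

module Construction (n : ℕ) .{{_ : NonZero n}} (a : Fin (3 * n) → ℕ) where

  m : ℕ
  m = maxX n a

  k : ℕ
  k = m ∸ 3 * n

  X' : List ℕ
  X' = map (λ x → 2 * x ∸ 1) (Xlist n a)

  B' : ℕ
  B' = sum X' / n

  Z : List ℕ
  Z = map (λ i → 2 * i + 1) (upTo m)

  ys : List ℕ
  ys = reverse (filter (λ z → ¬? (z ∈? X')) Z)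

  qLen : ℕ → ℕ
  qLen j = 2 * (2 * m + 1 ∸ j) + 1

  -- S_1,Q_1,…,S_n,Q_n
  part1 : List Seg
  part1 = concatMap (λ i → (B' , nothing) ∷ (qLen (suc i) , just (suc i)) ∷ []) (upTo n)

  -- S'_1,Q_{n+1},…,S'_k,Q_{n+k}
  part2 : List Seg
  part2 = concat (zipWith (λ i y → (y , nothing) ∷ (qLen (n + suc i) , just (n + suc i)) ∷ [])
                          (upTo k) ys)

  -- Q_{n+k+1},…,Q_{m+1}
  part3 : List Seg
  part3 = map (λ j → (qLen j , just j)) (map (λ t → n + k + suc t) (upTo (m + 1 ∸ (n + k))))

  segs : List Seg
  segs = part1 ++ part2 ++ part3

  L : ℕ
  L = sum (map proj₁ segs)

  Qs : List (ℕ × ℕ × ℕ)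
  Qs = layout 0 segs

  Valid : GV → Set
  Valid (pv p) = p < L
  Valid (qv j x) = ∃[ off ] ∃[ s ] ((j , off , s) ∈ Qs × 1 ≤ x × x < s)

  -- q_{jx} adjacent exactly to w_x and w_{x+1} of Q_j (w_x = pv (off + x - 1))
  data RAdj : GV → GV → Set where
    path→ : ∀ {p} → RAdj (pv p) (pv (suc p))
    path← : ∀ {p} → RAdj (pv (suc p)) (pv p)
    qw₁ : ∀ {j off s x} → (j , off , s) ∈ Qs → RAdj (qv j x) (pv (off + x ∸ 1))
    qw₂ : ∀ {j off s x} → (j , off , s) ∈ Qs → RAdj (qv j x) (pv (off + x))
    wq₁ : ∀ {j off s x} → (j , off , s) ∈ Qs → RAdj (pv (off + x ∸ 1)) (qv j x)
    wq₂ : ∀ {j off s x} → (j , off , s) ∈ Qs → RAdj (pv (off + x)) (qv j x)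

  G : Graph
  G = record { V = Σ GV Valid ; Adj = λ u v → RAdj (proj₁ u) (proj₁ v) }

Gp : (n : ℕ) .{{_ : NonZero n}} → (Fin (3 * n) → ℕ) → Graph
Gp n a = Construction.G n a

-- Cut P into 2m+1 consecutive blocks of odd length 2r+1: each Q_j is one block of radius 2m+1-j,
-- each S′_i is one block whose radius is taken from Y, and each S_i splits along its triple
-- {a, b, c} into blocks of radii a-1, b-1, c-1, because B′ = (2a-1) + (2b-1) + (2c-1).
-- These 2m+1 radii are distinct and at most 2m. Lighting the centre of the block of radius r
-- at step 2m+1-r burns P, and every q_{jx} is within r of the centre of Q_j as well. Conversely,
-- the position on P changes by at most one along an edge, so a burning sequence of length j
-- reaches at most 1 + 3 + … + (2j-1) = j² of the (2m+1)² vertices of P.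

module Submission where

open import Defs
open import Data.Nat using (ℕ; zero; suc; _+_; _*_; _∸_; _≤_; _<_; _⊔_; z≤n; s≤s; s≤s⁻¹; NonZero; >-nonZero⁻¹; _≟_; _<?_; _≤?_)
open import Data.Nat.Properties
open import Data.Nat.DivMod using (_/_; m*n/n≡m)
open import Data.Nat.Tactic.RingSolver using (solve-∀)
open import Data.Nat.ListAction using (sum)
open import Data.Fin using (Fin; toℕ; fromℕ<) renaming (zero to fzero; suc to fsuc)
import Data.Fin.Properties as Fin
open import Data.List using (List; []; _∷_; map; foldr; upTo; allFin; filter; reverse; concat; concatMap; zipWith; _++_; length; applyUpTo)
import Data.List.Properties as List
open import Data.List.Membership.Propositional using (_∈_; _∉_)
open import Data.List.Membership.Propositional.Properties using (∈-++⁻; ∈-map⁺; ∈-map⁻; ∈-filter⁻; ∈-allFin; ∈-upTo⁻)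
open import Data.List.Membership.DecPropositional _≟_ using (_∈?_)
open import Data.List.Relation.Unary.Any using (here; there)
import Data.List.Relation.Unary.Any.Properties as Any
open import Data.List.Relation.Unary.All using (All; []; _∷_)
import Data.List.Relation.Unary.All as All
open import Data.List.Relation.Unary.All.Properties.Core using (¬Any⇒All¬; All¬⇒¬Any)
open import Data.List.Relation.Unary.Unique.Propositional using (Unique; []; _∷_)
open import Data.List.Relation.Unary.Unique.Propositional.Properties using (filter⁺; upTo⁺; map⁺; ++⁺; allFin⁺)
import Data.List.Relation.Binary.Permutation.Setoid.Properties as Perm
open import Data.List.Relation.Binary.Permutation.Propositional using (↭⇒↭ₛ; ↭-sym)
open import Data.List.Relation.Binary.Permutation.Propositional.Properties using (↭-reverse)
open import Data.Maybe using (Maybe; just; nothing)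
open import Data.Product using (∃-syntax; _×_; _,_; proj₁; proj₂)
open import Data.Sum using (_⊎_; inj₁; inj₂; [_,_])
open import Data.Empty using (⊥; ⊥-elim)
open import Relation.Nullary using (¬_; yes; no; ¬?)
open import Relation.Unary using (Pred; Decidable)
open import Relation.Binary using (tri<; tri≈; tri>)
open import Relation.Binary.PropositionalEquality hiding ([_])
open import Function.Definitions using (Injective)

private variable
  A C D E : Set

∈⇒≤max : ∀ {x} xs → x ∈ xs → x ≤ foldr _⊔_ 0 xs
∈⇒≤max (y ∷ ys) (here refl) = m≤m⊔n y _
∈⇒≤max (y ∷ ys) (there p) = ≤-trans (∈⇒≤max ys p) (m≤n⊔m y _)

Unique-reverse : {xs : List A} → Unique xs → Unique (reverse xs)
Unique-reverse {A = A} {xs} = Perm.Unique-resp-↭ (setoid A) (↭⇒↭ₛ (↭-sym (↭-reverse xs)))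

filter-map : ∀ {p} {P : Pred C p} (P? : Decidable P) (f : A → C) (xs : List A) →
  filter P? (map f xs) ≡ map f (filter (λ x → P? (f x)) xs)
filter-map P? f [] = refl
filter-map P? f (x ∷ xs) with P? (f x)
... | yes _ = cong (f x ∷_) (filter-map P? f xs)
... | no _ = filter-map P? f xs

length-filter-¬ : ∀ {p} {P : Pred A p} (P? : Decidable P) xs →
  length (filter P? xs) + length (filter (λ x → ¬? (P? x)) xs) ≡ length xs
length-filter-¬ P? [] = refl
length-filter-¬ P? (x ∷ xs) with P? x
... | yes _ = cong suc (length-filter-¬ P? xs)
... | no _ = trans (+-suc _ _) (cong suc (length-filter-¬ P? xs))

applyUpTo≡map-allFin : ∀ (f : ℕ → A) n → applyUpTo f n ≡ map (λ i → f (toℕ i)) (allFin n)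
applyUpTo≡map-allFin f zero = refl
applyUpTo≡map-allFin f (suc n) = cong (f 0 ∷_) (trans (applyUpTo≡map-allFin (λ i → f (suc i)) n)
  (trans (List.map-tabulate (λ x → x) (λ i → f (suc (toℕ i)))) (sym (List.map-tabulate fsuc (λ i → f (toℕ i))))))

∈-concatMap⁻′ : ∀ {G : A → List D} {x} l → x ∈ concatMap G l → ∃[ i ] (i ∈ l × x ∈ G i)
∈-concatMap⁻′ {G = G} (i ∷ l) p with ∈-++⁻ (G i) p
... | inj₁ q = i , here refl , q
... | inj₂ q = let (i′ , i′∈l , x∈G) = ∈-concatMap⁻′ l q in i′ , there i′∈l , x∈G

∈-concat-zipWith⁻ : ∀ {G : A → C → List D} {x} l₁ l₂ → x ∈ concat (zipWith G l₁ l₂) →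
  ∃[ i ] ∃[ y ] (i ∈ l₁ × y ∈ l₂ × x ∈ G i y)
∈-concat-zipWith⁻ {G = G} (i ∷ l₁) (y ∷ l₂) p with ∈-++⁻ (G i y) p
... | inj₁ q = i , y , here refl , here refl , q
... | inj₂ q = let (i′ , y′ , a , b , c) = ∈-concat-zipWith⁻ l₁ l₂ q in i′ , y′ , there a , there b , c

map-concat-zipWith : ∀ (f : D → E) (G : A → C → List D) l₁ l₂ →
  map f (concat (zipWith G l₁ l₂)) ≡ concat (zipWith (λ i y → map f (G i y)) l₁ l₂)
map-concat-zipWith f G [] l₂ = refl
map-concat-zipWith f G (x ∷ l₁) [] = refl
map-concat-zipWith f G (x ∷ l₁) (y ∷ l₂) = trans (List.map-++ f (G x y) _) (cong (map f (G x y) ++_) (map-concat-zipWith f G l₁ l₂))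

Unique-concatMap : ∀ (G : A → List D) l → Unique l → (∀ {i} → i ∈ l → Unique (G i)) →
  (∀ {i i′ x} → i ∈ l → i′ ∈ l → x ∈ G i → x ∈ G i′ → i ≡ i′) → Unique (concatMap G l)
Unique-concatMap G [] u uG apart = []
Unique-concatMap G (i ∷ l) (i∉l ∷ u) uG apart =
  ++⁺ (uG (here refl)) (Unique-concatMap G l u (λ p → uG (there p)) (λ p q → apart (there p) (there q)))
    λ (x∈Gi , x∈rest) → let (i′ , i′∈l , x∈Gi′) = ∈-concatMap⁻′ l x∈rest in
      All¬⇒¬Any i∉l (subst (_∈ l) (sym (apart (here refl) (there i′∈l) x∈Gi x∈Gi′)) i′∈l)

Unique-concat-zipWith : ∀ (G : A → C → List D) l₁ l₂ → Unique l₁ → Unique l₂ →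
  (∀ {i y} → i ∈ l₁ → y ∈ l₂ → Unique (G i y)) →
  (∀ {i i′ y y′ x} → i ∈ l₁ → i′ ∈ l₁ → y ∈ l₂ → y′ ∈ l₂ → x ∈ G i y → x ∈ G i′ y′ → i ≡ i′ ⊎ y ≡ y′) →
  Unique (concat (zipWith G l₁ l₂))
Unique-concat-zipWith G [] l₂ u₁ u₂ uG apart = []
Unique-concat-zipWith G (i ∷ l₁) [] u₁ u₂ uG apart = []
Unique-concat-zipWith G (i ∷ l₁) (y ∷ l₂) (i∉ ∷ u₁) (y∉ ∷ u₂) uG apart =
  ++⁺ (uG (here refl) (here refl))
      (Unique-concat-zipWith G l₁ l₂ u₁ u₂ (λ p q → uG (there p) (there q)) (λ p q r s → apart (there p) (there q) (there r) (there s)))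
    λ (x∈G , x∈rest) → let (i′ , y′ , i′∈ , y′∈ , x∈G′) = ∈-concat-zipWith⁻ l₁ l₂ x∈rest in
      [ (λ e → All¬⇒¬Any i∉ (subst (_∈ l₁) (sym e) i′∈)) , (λ e → All¬⇒¬Any y∉ (subst (_∈ l₂) (sym e) y′∈)) ]
        (apart (here refl) (there i′∈) (here refl) (there y′∈) x∈G x∈G′)

Unique-map-injectiveOn : ∀ (f : A → D) l → Unique l → (∀ {x y} → x ∈ l → y ∈ l → f x ≡ f y → x ≡ y) → Unique (map f l)
Unique-map-injectiveOn f [] u inj = []
Unique-map-injectiveOn f (x ∷ l) (x∉ ∷ u) inj =
  ¬Any⇒All¬ _ (λ fx∈ → let (y , y∈ , e) = ∈-map⁻ f fx∈ in All¬⇒¬Any x∉ (subst (_∈ l) (inj (there y∈) (here refl) (sym e)) y∈))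
  ∷ Unique-map-injectiveOn f l u (λ p q → inj (there p) (there q))

length-concatMap : ∀ (G : A → List D) c l → (∀ x → length (G x) ≡ c) → length (concatMap G l) ≡ c * length l
length-concatMap G c [] h = sym (*-zeroʳ c)
length-concatMap G c (x ∷ l) h = trans (List.length-++ (G x)) (trans (cong₂ _+_ (h x) (length-concatMap G c l h)) (sym (*-suc c _)))

length-concat-zipWith : ∀ (G : A → C → List D) c l₁ l₂ → (∀ x y → length (G x y) ≡ c) → length l₁ ≤ length l₂ →
  length (concat (zipWith G l₁ l₂)) ≡ c * length l₁
length-concat-zipWith G c [] l₂ h le = sym (*-zeroʳ c)
length-concat-zipWith G c (x ∷ l₁) (y ∷ l₂) h (s≤s le) =
  trans (List.length-++ (G x y)) (trans (cong₂ _+_ (h x y) (length-concat-zipWith G c l₁ l₂ h le)) (sym (*-suc c _)))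

+-lc : ∀ a b c → a + (b + c) ≡ b + (a + c)
+-lc = solve-∀

remove : ℕ → List ℕ → List ℕ
remove y = filter (λ x → ¬? (x ≟ y))

oddSum : List ℕ → ℕ
oddSum xs = sum (map (λ r → 2 * r + 1) xs)

module _ {y : ℕ} where

  private
    remove-head : ∀ xs → All (λ x → ¬ y ≡ x) xs → remove y (y ∷ xs) ≡ xs
    remove-head xs y∉ = trans (List.filter-reject (λ x → ¬? (x ≟ y)) (λ ne → ne refl))
                              (List.filter-all (λ x → ¬? (x ≟ y)) (All.map (λ ne e → ne (sym e)) y∉))

    remove-other : ∀ {x} xs → All (λ z → ¬ x ≡ z) xs → y ∈ xs → remove y (x ∷ xs) ≡ x ∷ remove y xs
    remove-other xs x∉ y∈ = List.filter-accept (λ x → ¬? (x ≟ y)) (λ e → All.lookup x∉ y∈ e)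

  length-remove : ∀ xs → Unique xs → y ∈ xs → length xs ≡ suc (length (remove y xs))
  length-remove (x ∷ xs) (x∉ ∷ u) (here refl) = cong suc (cong length (sym (remove-head xs x∉)))
  length-remove (x ∷ xs) (x∉ ∷ u) (there y∈) rewrite remove-other xs x∉ y∈ = cong suc (length-remove xs u y∈)

  oddSum-remove : ∀ xs → Unique xs → y ∈ xs → oddSum xs ≡ (2 * y + 1) + oddSum (remove y xs)
  oddSum-remove (x ∷ xs) (x∉ ∷ u) (here refl) = cong (λ l → (2 * x + 1) + oddSum l) (sym (remove-head xs x∉))
  oddSum-remove (x ∷ xs) (x∉ ∷ u) (there y∈) rewrite remove-other xs x∉ y∈ =
    trans (cong ((2 * x + 1) +_) (oddSum-remove xs u y∈)) (+-lc (2 * x + 1) (2 * y + 1) _)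

  ∈-remove⁻ : ∀ {x} xs → x ∈ remove y xs → x ∈ xs × ¬ x ≡ y
  ∈-remove⁻ xs = ∈-filter⁻ (λ x → ¬? (x ≟ y)) {xs = xs}

  Unique-remove : ∀ {xs} → Unique xs → Unique (remove y xs)
  Unique-remove = filter⁺ (λ x → ¬? (x ≟ y))

∈-tail : ∀ {x y : A} {ys} → x ∈ y ∷ ys → x ≢ y → x ∈ ys
∈-tail (here x≡y) x≢y = ⊥-elim (x≢y x≡y)
∈-tail (there x∈ys) _ = x∈ys

Unique-⊆⇒length≤ : ∀ (xs ys : List ℕ) → Unique xs → (∀ {x} → x ∈ xs → x ∈ ys) → length xs ≤ length ys
Unique-⊆⇒length≤ [] ys u xs⊆ys = z≤n
Unique-⊆⇒length≤ (x ∷ xs) [] u xs⊆ys with () ← xs⊆ys (here refl)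
Unique-⊆⇒length≤ xs@(_ ∷ _) (y ∷ ys) u xs⊆ys with y ∈? xs
... | no y∉xs = m≤n⇒m≤1+n (Unique-⊆⇒length≤ xs ys u (λ x∈ → ∈-tail (xs⊆ys x∈) (λ { refl → y∉xs x∈ })))
... | yes y∈xs = subst (_≤ suc (length ys)) (sym (length-remove xs u y∈xs))
  (s≤s (Unique-⊆⇒length≤ (remove y xs) ys (Unique-remove u)
    (λ x∈ → let (x∈xs , x≢y) = ∈-remove⁻ xs x∈ in ∈-tail (xs⊆ys x∈xs) x≢y)))

suc²≡ : ∀ l → suc l * suc l ≡ (2 * l + 1) + l * l
suc²≡ = solve-∀

length²≤oddSum-bounded : ∀ K xs → Unique xs → All (_< K) xs → length xs * length xs ≤ oddSum xs × length xs ≤ K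
length²≤oddSum-bounded zero [] u bound = z≤n , z≤n
length²≤oddSum-bounded zero (x ∷ xs) u (() ∷ _)
length²≤oddSum-bounded (suc K) xs u bound with K ∈? xs
... | no K∉ = let (sq , len) = length²≤oddSum-bounded K xs u (below K∉) in sq , m≤n⇒m≤1+n len
  where below : K ∉ xs → All (_< K) xs
        below K∉ = All.tabulate (λ {x} x∈ → ≤∧≢⇒< (s≤s⁻¹ (All.lookup bound x∈)) (λ { refl → K∉ x∈ }))
... | yes K∈ =
  let l = length (remove K xs)
      bound′ : All (_< K) (remove K xs)
      bound′ = All.tabulate (λ x∈ → let (x∈xs , x≢K) = ∈-remove⁻ xs x∈ in ≤∧≢⇒< (s≤s⁻¹ (All.lookup bound x∈xs)) x≢K)
      (sq , len) = length²≤oddSum-bounded K (remove K xs) (Unique-remove u) bound′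
  in subst (λ t → t * t ≤ oddSum xs) (sym (length-remove xs u K∈))
       (subst₂ _≤_ (sym (suc²≡ l)) (sym (oddSum-remove xs u K∈)) (+-mono-≤ (+-monoˡ-≤ 1 (*-monoʳ-≤ 2 len)) sq)) ,
     subst (_≤ suc K) (sym (length-remove xs u K∈)) (s≤s len)

length²≤oddSum : ∀ K xs → Unique xs → All (_< K) xs → length xs * length xs ≤ oddSum xs
length²≤oddSum K xs u bound = proj₁ (length²≤oddSum-bounded K xs u bound)

sum-2x∸1 : ∀ xs → All (1 ≤_) xs → sum (map (λ x → 2 * x ∸ 1) xs) + length xs ≡ 2 * sum xs
sum-2x∸1 [] [] = refl
sum-2x∸1 (suc x ∷ xs) (_ ∷ xs≥1) = begin
  (x + suc (x + 0)) + s′ + suc (length xs) ≡⟨ regroup x s′ (length xs) ⟩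
  suc (suc (x + x + (s′ + length xs)))   ≡⟨ cong (λ z → suc (suc (x + x + z))) (sum-2x∸1 xs xs≥1) ⟩
  suc (suc (x + x + 2 * sum xs))         ≡⟨ double x (sum xs) ⟩
  2 * (suc x + sum xs)                    ∎
  where
  open ≡-Reasoning
  s′ : ℕ
  s′ = sum (map (λ x → 2 * x ∸ 1) xs)
  regroup : ∀ x s l → (x + suc (x + 0)) + s + suc l ≡ suc (suc (x + x + (s + l)))
  regroup = solve-∀
  double : ∀ x s → suc (suc (x + x + 2 * s)) ≡ 2 * (suc x + s)
  double = solve-∀

-- Coding the pairs (ρ, d) with d ≤ 2ρ by ρ² + d

square-code< : ∀ ρ d → d ≤ 2 * ρ → ρ * ρ + d < suc ρ * suc ρ
square-code< ρ d d≤ = subst (suc (ρ * ρ + d) ≤_) (sym (suc²≡ ρ))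
  (subst (_≤ (2 * ρ + 1) + ρ * ρ) (reorder ρ d) (+-monoˡ-≤ (ρ * ρ) (+-monoˡ-≤ 1 d≤)))
  where reorder : ∀ ρ d → (d + 1) + ρ * ρ ≡ suc (ρ * ρ + d)
        reorder = solve-∀

square-code-injective : ∀ ρ ρ′ d d′ → d ≤ 2 * ρ → d′ ≤ 2 * ρ′ → ρ * ρ + d ≡ ρ′ * ρ′ + d′ → ρ ≡ ρ′
square-code-injective ρ ρ′ d d′ d≤ d′≤ e with <-cmp ρ ρ′
... | tri≈ _ ρ≡ρ′ _ = ρ≡ρ′
... | tri< ρ<ρ′ _ _ = ⊥-elim (<-irrefl e (<-≤-trans (square-code< ρ d d≤) (≤-trans (*-mono-≤ ρ<ρ′ ρ<ρ′) (m≤m+n (ρ′ * ρ′) d′))))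
... | tri> _ _ ρ>ρ′ = ⊥-elim (<-irrefl (sym e) (<-≤-trans (square-code< ρ′ d′ d′≤) (≤-trans (*-mono-≤ ρ>ρ′ ρ>ρ′) (m≤m+n (ρ * ρ) d))))

Dist≤-mono : ∀ {G : Graph} {c d u v} → c ≤ d → Dist≤ G c u v → Dist≤ G d u v
Dist≤-mono c≤d here = here
Dist≤-mono (s≤s c≤d) (step uw w⇝v) = step uw (Dist≤-mono c≤d w⇝v)

Near : ℕ → ℕ → ℕ → Set
Near d x y = x ≤ d + y × y ≤ d + x

Near-sym : ∀ {d x y} → Near d x y → Near d y x
Near-sym (x≤ , y≤) = y≤ , x≤

Near-refl : ∀ d x → Near d x x
Near-refl d x = m≤n+m x d , m≤n+m x d

Near-pred : ∀ y → Near 1 (y ∸ 1) y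
Near-pred zero = z≤n , z≤n
Near-pred (suc y) = m≤n+m y 2 , ≤-refl

-- A burning sequence of length j whose sources are graded by a 1-Lipschitz position map
-- can reach at most j² distinct positions: source i covers only the 2ρ+1 positions within
-- ρ = j - 1 - i of its own.
module LipschitzPosition (G : Graph) (pos : V G → ℕ) (pos-adj : ∀ {u v} → Adj G u v → Near 1 (pos u) (pos v)) where

  Dist≤⇒Near : ∀ {d u v} → Dist≤ G d u v → Near d (pos u) (pos v)
  Dist≤⇒Near {d} here = m≤n+m _ d , m≤n+m _ d
  Dist≤⇒Near {suc d} (step uw w⇝v) =
    let (u≤w , w≤u) = pos-adj uw
        (w≤v , v≤w) = Dist≤⇒Near w⇝v
    in ≤-trans u≤w (s≤s w≤v) , ≤-trans v≤w (≤-trans (+-monoʳ-≤ d w≤u) (≤-reflexive (+-suc d _)))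

  burning-covers≤square : ∀ {L} (vertex : Fin L → V G) → (∀ p → pos (vertex p) ≡ toℕ p) →
    ∀ j (b : Fin j → V G) → IsBurningSeq G j b → L ≤ j * j
  burning-covers≤square {L} vertex pos-vertex j b burn = Fin.injective⇒≤ code-injective
    where
    source : Fin L → Fin j
    source p = proj₁ (burn (vertex p))

    ρ : Fin L → ℕ
    ρ p = j ∸ suc (toℕ (source p))

    centre : Fin L → ℕ
    centre p = pos (b (source p))

    near : ∀ p → Near (ρ p) (toℕ p) (centre p)
    near p = subst (λ x → Near (ρ p) x (centre p)) (pos-vertex p) (Dist≤⇒Near (proj₂ (burn (vertex p))))

    offset : Fin L → ℕ
    offset p = ρ p + toℕ p ∸ centre p

    offset≤ : ∀ p → offset p ≤ 2 * ρ p
    offset≤ p = m≤n+o⇒m∸n≤o (ρ p + toℕ p) (centre p)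
      (≤-trans (+-monoʳ-≤ (ρ p) (proj₁ (near p))) (≤-reflexive (double (centre p) (ρ p))))
      where double : ∀ c ρ → ρ + (ρ + c) ≡ c + 2 * ρ
            double = solve-∀

    ρ< : ∀ p → ρ p < j
    ρ< p = ∸-monoʳ-< {o = 0} (s≤s z≤n) (Fin.toℕ<n (source p))

    code : Fin L → ℕ
    code p = ρ p * ρ p + offset p

    code< : ∀ p → code p < j * j
    code< p = <-≤-trans (square-code< (ρ p) (offset p) (offset≤ p)) (*-mono-≤ (ρ< p) (ρ< p))

    code-injective : Injective _≡_ _≡_ (λ p → fromℕ< (code< p))
    code-injective {p} {p′} e = Fin.toℕ-injective (+-cancelˡ-≡ (ρ p) _ _ (trans same-sum (cong (_+ toℕ p′) (sym same-ρ))))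
      where
      same-code : code p ≡ code p′
      same-code = trans (sym (Fin.toℕ-fromℕ< (code< p))) (trans (cong toℕ e) (Fin.toℕ-fromℕ< (code< p′)))
      same-ρ : ρ p ≡ ρ p′
      same-ρ = square-code-injective _ _ _ _ (offset≤ p) (offset≤ p′) same-code
      same-offset : offset p ≡ offset p′
      same-offset = +-cancelˡ-≡ (ρ p * ρ p) _ _ (trans same-code (cong (λ z → z * z + offset p′) (sym same-ρ)))
      same-centre : centre p ≡ centre p′
      same-centre = cong (λ i → pos (b i)) (Fin.toℕ-injective (suc-injective
        (∸-cancelˡ-≡ (Fin.toℕ<n (source p)) (Fin.toℕ<n (source p′)) same-ρ)))
      same-sum : ρ p + toℕ p ≡ ρ p′ + toℕ p′
      same-sum = ∸-cancelʳ-≡ (proj₂ (near p)) (subst (_≤ ρ p′ + toℕ p′) (sym same-centre) (proj₂ (near p′)))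
                   (trans same-offset (cong (ρ p′ + toℕ p′ ∸_) (sym same-centre)))

valueOf : (key val : A → ℕ) → ℕ → List A → ℕ
valueOf key val k [] = 0
valueOf key val k (x ∷ xs) with k ≟ key x
... | yes _ = val x
... | no _ = valueOf key val k xs

valueOf-∈ : ∀ (key val : A → ℕ) {x} xs → (∀ {y} → y ∈ xs → key y ≡ key x → val y ≡ val x) →
  x ∈ xs → valueOf key val (key x) xs ≡ val x
valueOf-∈ key val {x} (y ∷ xs) functional x∈ with key x ≟ key y
... | yes e = functional (here refl) (sym e)
... | no ne with x∈
...   | here refl = ⊥-elim (ne refl)
...   | there x∈xs = valueOf-∈ key val xs (λ y∈ → functional (there y∈)) x∈xs

-- A block of radius r has 2r+1 vertices; it carries the tag j when it is the path Q_j.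
Block : Set
Block = ℕ × Maybe ℕ

blockSeg : Block → Seg
blockSeg (r , t) = (2 * r + 1 , t)

pathLength : List Seg → ℕ
pathLength l = sum (map proj₁ l)

pathLength-oddSum : ∀ bl → pathLength (map blockSeg bl) ≡ oddSum (map proj₁ bl)
pathLength-oddSum [] = refl
pathLength-oddSum ((r , _) ∷ bl) = cong ((2 * r + 1) +_) (pathLength-oddSum bl)

-- (radius, tag, offset of the first vertex)
PlacedBlock : Set
PlacedBlock = ℕ × Maybe ℕ × ℕ

place : ℕ → List Block → List PlacedBlock
place pos [] = []
place pos ((r , t) ∷ bl) = (r , t , pos) ∷ place (pos + (2 * r + 1)) bl

block-containing : ∀ bl pos p → pos ≤ p → p < pos + pathLength (map blockSeg bl) →
  ∃[ r ] ∃[ t ] ∃[ off ] ((r , t , off) ∈ place pos bl × off ≤ p × p < off + (2 * r + 1))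
block-containing [] pos p pos≤p p< = ⊥-elim (<-irrefl refl (≤-<-trans pos≤p (subst (p <_) (+-identityʳ pos) p<)))
block-containing ((r , t) ∷ bl) pos p pos≤p p< with p <? pos + (2 * r + 1)
... | yes p<end = r , t , pos , here refl , pos≤p , p<end
... | no p≮end =
  let (r′ , t′ , off , b∈ , off≤p , p<) = block-containing bl (pos + (2 * r + 1)) p (≮⇒≥ p≮end)
                                            (subst (p <_) (sym (+-assoc pos (2 * r + 1) _)) p<)
  in r′ , t′ , off , there b∈ , off≤p , p<

∈-place⇒∈ : ∀ bl pos {r t off} → (r , t , off) ∈ place pos bl → (r , t) ∈ bl
∈-place⇒∈ (_ ∷ bl) pos (here refl) = here refl
∈-place⇒∈ (_ ∷ bl) pos (there b∈) = there (∈-place⇒∈ bl _ b∈)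

place-within : ∀ bl pos {r t off} → (r , t , off) ∈ place pos bl →
  off + (2 * r + 1) ≤ pos + pathLength (map blockSeg bl)
place-within ((r , t) ∷ bl) pos (here refl) = +-monoʳ-≤ pos (m≤m+n _ _)
place-within ((r , t) ∷ bl) pos (there b∈) = ≤-trans (place-within bl _ b∈) (≤-reflexive (+-assoc pos _ _))

layout-place : ∀ bl pos {j off s} → (j , off , s) ∈ layout pos (map blockSeg bl) →
  ∃[ r ] ((r , just j , off) ∈ place pos bl × s ≡ 2 * r + 1)
layout-place ((r , nothing) ∷ bl) pos q∈ = let (r′ , b∈ , e) = layout-place bl _ q∈ in r′ , there b∈ , e
layout-place ((r , just j) ∷ bl) pos (here refl) = r , here refl , refl
layout-place ((r , just j) ∷ bl) pos (there q∈) = let (r′ , b∈ , e) = layout-place bl _ q∈ in r′ , there b∈ , e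

place-radius-unique : ∀ bl pos {r t off t′ off′} → Unique (map proj₁ bl) →
  (r , t , off) ∈ place pos bl → (r , t′ , off′) ∈ place pos bl → t ≡ t′ × off ≡ off′
place-radius-unique (_ ∷ bl) pos u (here refl) (here refl) = refl , refl
place-radius-unique (_ ∷ bl) pos (r∉ ∷ u) (here refl) (there b∈) = ⊥-elim (All¬⇒¬Any r∉ (∈-map⁺ proj₁ (∈-place⇒∈ bl _ b∈)))
place-radius-unique (_ ∷ bl) pos (r∉ ∷ u) (there b∈) (here refl) = ⊥-elim (All¬⇒¬Any r∉ (∈-map⁺ proj₁ (∈-place⇒∈ bl _ b∈)))
place-radius-unique (_ ∷ bl) pos (r∉ ∷ u) (there b∈) (there b∈′) = place-radius-unique bl _ u b∈ b∈′

data Refines : List Seg → List Block → Set where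
  []    : Refines [] []
  one   : ∀ {r t l bl} → Refines l bl → Refines ((2 * r + 1 , t) ∷ l) ((r , t) ∷ bl)
  three : ∀ {s r₁ r₂ r₃ l bl} → s ≡ (2 * r₁ + 1) + (2 * r₂ + 1) + (2 * r₃ + 1) → Refines l bl →
          Refines ((s , nothing) ∷ l) ((r₁ , nothing) ∷ (r₂ , nothing) ∷ (r₃ , nothing) ∷ bl)

layout-refines : ∀ {l bl} → Refines l bl → ∀ pos → layout pos l ≡ layout pos (map blockSeg bl)
layout-refines [] pos = refl
layout-refines (one {t = nothing} R) pos = layout-refines R _
layout-refines (one {t = just j} R) pos = cong (_ ∷_) (layout-refines R _)
layout-refines (three {r₁ = r₁} {r₂} {r₃} {bl = bl} refl R) pos =
  trans (layout-refines R _) (cong (λ z → layout z (map blockSeg bl)) (regroup pos _ _ _))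
  where regroup : ∀ p a b c → p + (a + b + c) ≡ p + a + b + c
        regroup = solve-∀

pathLength-refines : ∀ {l bl} → Refines l bl → pathLength l ≡ pathLength (map blockSeg bl)
pathLength-refines [] = refl
pathLength-refines (one {r = r} R) = cong ((2 * r + 1) +_) (pathLength-refines R)
pathLength-refines (three {r₁ = r₁} {r₂} {r₃} refl R) =
  trans (cong (_ +_) (pathLength-refines R)) (regroup (2 * r₁ + 1) (2 * r₂ + 1) (2 * r₃ + 1) _)
  where regroup : ∀ a b c p → a + b + c + p ≡ a + (b + (c + p))
        regroup = solve-∀

Refines-++ : ∀ {l bl l′ bl′} → Refines l bl → Refines l′ bl′ → Refines (l ++ l′) (bl ++ bl′)
Refines-++ [] R′ = R′
Refines-++ (one R) R′ = one (Refines-++ R R′)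
Refines-++ (three e R) R′ = three e (Refines-++ R R′)

Refines-concatMap : ∀ {F : A → List Seg} {G : A → List Block} l → (∀ x → Refines (F x) (G x)) →
  Refines (concatMap F l) (concatMap G l)
Refines-concatMap [] R = []
Refines-concatMap (x ∷ l) R = Refines-++ (R x) (Refines-concatMap l R)

Refines-concat-zipWith : ∀ {F : ℕ → ℕ → List Seg} {G : ℕ → ℕ → List Block} (f : ℕ → ℕ) l₁ l₂ →
  (∀ i r → Refines (F i (f r)) (G i r)) → Refines (concat (zipWith F l₁ (map f l₂))) (concat (zipWith G l₁ l₂))
Refines-concat-zipWith f [] l₂ R = []
Refines-concat-zipWith f (i ∷ l₁) [] R = []
Refines-concat-zipWith f (i ∷ l₁) (r ∷ l₂) R = Refines-++ (R i r) (Refines-concat-zipWith f l₁ l₂ R)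

module GpBurning (n B : ℕ) .{{_ : NonZero n}} (a : Fin (3 * n) → ℕ)
  (a-injective : Injective _≡_ _≡_ a) (sum-a : sum (Xlist n a) ≡ n * B)
  (a-bounds : ∀ i → B < 4 * a i × 2 * a i < B) (partition : ThreePartition n B a) where

  open Construction n a

  σ : Fin n × Fin 3 → Fin (3 * n)
  σ = proj₁ partition

  σ-injective : ∀ {x y} → σ x ≡ σ y → x ≡ y
  σ-injective = proj₁ (proj₁ (proj₂ partition))

  triple-sum : ∀ i → a (σ (i , fzero)) + a (σ (i , fsuc fzero)) + a (σ (i , fsuc (fsuc fzero))) ≡ B
  triple-sum = proj₂ (proj₂ partition)

  a≥1 : ∀ s → 1 ≤ a s
  a≥1 s with a s | a-bounds s
  ... | zero | () , _
  ... | suc _ | _ = s≤s z≤n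

  B≥3 : 3 ≤ B
  B≥3 = ≤-trans (s≤s (*-monoʳ-≤ 2 (a≥1 s₀))) (proj₂ (a-bounds s₀))
    where s₀ : Fin (3 * n)
          s₀ = σ (fromℕ< (>-nonZero⁻¹ n) , fzero)

  a≤m : ∀ s → a s ≤ m
  a≤m s = ∈⇒≤max (Xlist n a) (∈-map⁺ a (∈-allFin s))

  -- The element a_s of X becomes the odd number 2 a_s - 1 of X′, a block of radius a_s - 1.
  xRadius : Fin (3 * n) → ℕ
  xRadius s = a s ∸ 1

  xRadius<m : ∀ s → xRadius s < m
  xRadius<m s = ≤-trans (≤-reflexive (suc-∸1 (a≥1 s))) (a≤m s)
    where suc-∸1 : ∀ {x} → 1 ≤ x → suc (x ∸ 1) ≡ x
          suc-∸1 (s≤s z≤n) = refl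

  xRadius-injective : ∀ {s s′} → xRadius s ≡ xRadius s′ → s ≡ s′
  xRadius-injective {s} {s′} e = a-injective (∸-cancelʳ-≡ (a≥1 s) (a≥1 s′) e)

  3n≤m : 3 * n ≤ m
  3n≤m = Fin.injective⇒≤ {f = λ s → fromℕ< (xRadius<m s)}
    (λ e → xRadius-injective (trans (sym (Fin.toℕ-fromℕ< (xRadius<m _))) (trans (cong toℕ e) (Fin.toℕ-fromℕ< (xRadius<m _)))))

  3n+k≡m : 3 * n + k ≡ m
  3n+k≡m = m+[n∸m]≡n 3n≤m

  length-X : length (Xlist n a) ≡ 3 * n
  length-X = trans (List.length-map a (allFin (3 * n))) (List.length-tabulate (λ x → x))

  2B∸3+3 : 2 * B ∸ 3 + 3 ≡ 2 * B
  2B∸3+3 = m∸n+n≡m (≤-trans B≥3 (m≤m+n B _))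

  sum-X′ : sum X' ≡ n * (2 * B ∸ 3)
  sum-X′ = +-cancelʳ-≡ _ _ _ (begin
    sum X' + 3 * n                      ≡⟨ cong (sum X' +_) (sym length-X) ⟩
    sum X' + length (Xlist n a)         ≡⟨ sum-2x∸1 (Xlist n a) (All.tabulate λ x∈ → let (s , _ , e) = ∈-map⁻ a x∈ in subst (1 ≤_) (sym e) (a≥1 s)) ⟩
    2 * sum (Xlist n a)                 ≡⟨ cong (2 *_) sum-a ⟩
    2 * (n * B)                         ≡⟨ regroup n B ⟩
    n * (2 * B)                         ≡⟨ cong (n *_) (sym 2B∸3+3) ⟩
    n * (2 * B ∸ 3 + 3)                 ≡⟨ distrib n (2 * B ∸ 3) ⟩
    n * (2 * B ∸ 3) + 3 * n             ∎)
    where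
    open ≡-Reasoning
    regroup : ∀ n B → 2 * (n * B) ≡ n * (2 * B)
    regroup = solve-∀
    distrib : ∀ n T → n * (T + 3) ≡ n * T + 3 * n
    distrib = solve-∀

  B′≡2B∸3 : B' ≡ 2 * B ∸ 3
  B′≡2B∸3 = trans (cong (_/ n) (trans sum-X′ (*-comm n _))) (m*n/n≡m _ n)

  triple-radii : ∀ x y z → 1 ≤ x → 1 ≤ y → 1 ≤ z → x + y + z ≡ B →
    2 * B ∸ 3 ≡ (2 * (x ∸ 1) + 1) + (2 * (y ∸ 1) + 1) + (2 * (z ∸ 1) + 1)
  triple-radii (suc x) (suc y) (suc z) _ _ _ e = +-cancelʳ-≡ _ _ _ (trans 2B∸3+3 (trans (cong (2 *_) (sym e)) (regroup x y z)))
    where regroup : ∀ x y z → 2 * (suc x + suc y + suc z) ≡ ((2 * x + 1) + (2 * y + 1) + (2 * z + 1)) + 3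
          regroup = solve-∀

  qRadius : ℕ → ℕ
  qRadius j = 2 * m + 1 ∸ j

  qBlock : ℕ → Block
  qBlock j = (qRadius j , just j)

  tripleBlocks : Fin n → List Block
  tripleBlocks i = (xRadius (σ (i , fzero)) , nothing) ∷ (xRadius (σ (i , fsuc fzero)) , nothing)
                 ∷ (xRadius (σ (i , fsuc (fsuc fzero))) , nothing) ∷ qBlock (suc (toℕ i)) ∷ []

  blocks₁ : List Block
  blocks₁ = concatMap tripleBlocks (allFin n)

  refines₁ : Refines part1 blocks₁
  refines₁ = subst (λ l → Refines (concat l) blocks₁)
    (sym (trans (List.map-upTo S-Q n) (applyUpTo≡map-allFin S-Q n)))
    (Refines-concatMap (allFin n) λ i →
      three (trans B′≡2B∸3 (triple-radii _ _ _ (a≥1 _) (a≥1 _) (a≥1 _) (triple-sum i))) (one []))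
    where S-Q : ℕ → List Seg
          S-Q i = (B' , nothing) ∷ (qLen (suc i) , just (suc i)) ∷ []

  oddNat : ℕ → ℕ
  oddNat r = 2 * r + 1

  yRadii : List ℕ
  yRadii = reverse (filter (λ r → ¬? (oddNat r ∈? X')) (upTo m))

  ys≡ : ys ≡ map oddNat yRadii
  ys≡ = trans (cong reverse (filter-map (λ z → ¬? (z ∈? X')) oddNat (upTo m)))
              (sym (List.reverse-map oddNat (filter (λ r → ¬? (oddNat r ∈? X')) (upTo m))))

  yBlocks : ℕ → ℕ → List Block
  yBlocks i r = (r , nothing) ∷ qBlock (n + suc i) ∷ []

  blocks₂ : List Block
  blocks₂ = concat (zipWith yBlocks (upTo k) yRadii)

  refines₂ : Refines part2 blocks₂
  refines₂ = subst (λ l → Refines (concat (zipWith S′-Q (upTo k) l)) blocks₂) (sym ys≡)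
    (Refines-concat-zipWith oddNat (upTo k) yRadii (λ i r → one (one [])))
    where S′-Q : ℕ → ℕ → List Seg
          S′-Q i y = (y , nothing) ∷ (qLen (n + suc i) , just (n + suc i)) ∷ []

  tailTags : List ℕ
  tailTags = map (λ t → n + k + suc t) (upTo (m + 1 ∸ (n + k)))

  blocks₃ : List Block
  blocks₃ = map qBlock tailTags

  refines₃ : ∀ tags → Refines (map (λ j → (qLen j , just j)) tags) (map qBlock tags)
  refines₃ [] = []
  refines₃ (j ∷ tags) = one (refines₃ tags)

  blocks : List Block
  blocks = blocks₁ ++ blocks₂ ++ blocks₃

  placed : List PlacedBlock
  placed = place 0 blocks

  refines : Refines segs blocks
  refines = Refines-++ refines₁ (Refines-++ refines₂ (refines₃ tailTags))

  Qs≡ : Qs ≡ layout 0 (map blockSeg blocks)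
  Qs≡ = layout-refines refines 0

  L≡ : L ≡ pathLength (map blockSeg blocks)
  L≡ = pathLength-refines refines

  n+k≤m : n + k ≤ m
  n+k≤m = ≤-trans (+-monoˡ-≤ k (m≤m+n n _)) (≤-reflexive 3n+k≡m)

  n+k≤m+1 : n + k ≤ m + 1
  n+k≤m+1 = ≤-trans n+k≤m (m≤m+n m 1)

  n≤m+1 : n ≤ m + 1
  n≤m+1 = ≤-trans (m≤m+n n k) n+k≤m+1

  n+k+tail≡m+1 : n + k + (m + 1 ∸ (n + k)) ≡ m + 1
  n+k+tail≡m+1 = m+[n∸m]≡n n+k≤m+1

  m≤qRadius : ∀ {j} → j ≤ m + 1 → m ≤ qRadius j
  m≤qRadius {j} j≤ = ≤-trans (≤-reflexive (sym (2m+1∸[m+1]≡m m))) (∸-monoʳ-≤ (2 * m + 1) j≤)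
    where 2m+1∸[m+1]≡m : ∀ m → 2 * m + 1 ∸ (m + 1) ≡ m
          2m+1∸[m+1]≡m m = trans (cong (_∸ (m + 1)) (split m)) (m+n∸n≡m m (m + 1))
            where split : ∀ m → 2 * m + 1 ≡ m + (m + 1)
                  split = solve-∀

  qRadius<2m+1 : ∀ {j} → 1 ≤ j → qRadius j < 2 * m + 1
  qRadius<2m+1 {j} 1≤j = ≤-<-trans (∸-monoʳ-≤ (2 * m + 1) 1≤j)
    (subst (_< 2 * m + 1) (sym (m+n∸n≡m (2 * m) 1)) (m<m+n (2 * m) (s≤s z≤n)))

  qRadius-injective : ∀ {j j′} → j ≤ m + 1 → j′ ≤ m + 1 → qRadius j ≡ qRadius j′ → j ≡ j′
  qRadius-injective j≤ j′≤ = ∸-cancelˡ-≡ (≤-trans j≤ m+1≤2m+1) (≤-trans j′≤ m+1≤2m+1)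
    where m+1≤2m+1 : m + 1 ≤ 2 * m + 1
          m+1≤2m+1 = +-monoˡ-≤ 1 (m≤m+n m (m + 0))

  small≢qRadius : ∀ {r j} → j ≤ m + 1 → r < m → r ≢ qRadius j
  small≢qRadius j≤ r<m refl = <-irrefl refl (<-≤-trans r<m (m≤qRadius j≤))

  qRadius-apart : ∀ {j c j′} → j ≤ c → c < j′ → j′ ≤ m + 1 → qRadius j ≢ qRadius j′
  qRadius-apart j≤c c<j′ j′≤ e with qRadius-injective (≤-trans j≤c (≤-trans (n≤1+n _) (≤-trans c<j′ j′≤))) j′≤ e
  ... | refl = <-irrefl refl (≤-<-trans j≤c c<j′)

  ∈-yRadii⁻ : ∀ {r} → r ∈ yRadii → r < m × oddNat r ∉ X'
  ∈-yRadii⁻ r∈ = let (r∈upTo , r∉) = ∈-filter⁻ (λ r → ¬? (oddNat r ∈? X')) {xs = upTo m} (Any.reverse⁻ r∈)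
                 in ∈-upTo⁻ r∈upTo , r∉

  xRadius∉yRadii : ∀ s → xRadius s ∉ yRadii
  xRadius∉yRadii s r∈ = proj₂ (∈-yRadii⁻ r∈) (subst (_∈ X') (odd-pred (a s) (a≥1 s)) (∈-map⁺ _ (∈-map⁺ a (∈-allFin s))))
    where odd-pred : ∀ x → 1 ≤ x → 2 * x ∸ 1 ≡ oddNat (x ∸ 1)
          odd-pred (suc x) _ = shift x
            where shift : ∀ x → x + suc (x + 0) ≡ 2 * x + 1
                  shift = solve-∀

  ∈-blocks₁⁻ : ∀ {x} → x ∈ blocks₁ →
    (∃[ i ] ∃[ c ] (x ≡ (xRadius (σ (i , c)) , nothing))) ⊎ (∃[ i ] (x ≡ qBlock (suc (toℕ i))))
  ∈-blocks₁⁻ x∈ with ∈-concatMap⁻′ (allFin n) x∈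
  ... | i , _ , here e = inj₁ (i , _ , e)
  ... | i , _ , there (here e) = inj₁ (i , _ , e)
  ... | i , _ , there (there (here e)) = inj₁ (i , _ , e)
  ... | i , _ , there (there (there (here e))) = inj₂ (i , e)

  ∈-blocks₂⁻ : ∀ {x} → x ∈ blocks₂ → (∃[ r ] (r ∈ yRadii × x ≡ (r , nothing))) ⊎ (∃[ i ] (i < k × x ≡ qBlock (n + suc i)))
  ∈-blocks₂⁻ x∈ with ∈-concat-zipWith⁻ (upTo k) yRadii x∈
  ... | i , r , _ , r∈ , here e = inj₁ (r , r∈ , e)
  ... | i , r , i∈ , _ , there (here e) = inj₂ (i , ∈-upTo⁻ i∈ , e)

  ∈-tailTags⁻ : ∀ {j} → j ∈ tailTags → n + k < j × j ≤ m + 1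
  ∈-tailTags⁻ j∈ = let (t , t∈ , e) = ∈-map⁻ (λ t → n + k + suc t) j∈ in
    subst (n + k <_) (sym e) (m<m+n (n + k) (s≤s z≤n)) ,
    subst (_≤ m + 1) (sym e) (≤-trans (+-monoʳ-≤ (n + k) (∈-upTo⁻ t∈)) (≤-reflexive n+k+tail≡m+1))

  i<n⇒tag≤ : ∀ (i : Fin n) → suc (toℕ i) ≤ m + 1
  i<n⇒tag≤ i = ≤-trans (Fin.toℕ<n i) n≤m+1

  i<k⇒tag≤ : ∀ {i} → i < k → n + suc i ≤ m + 1
  i<k⇒tag≤ {i} i<k = ≤-trans (+-monoʳ-≤ n i<k) n+k≤m+1

  BlockShape : Block → Set
  BlockShape (r , t) = (t ≡ nothing × r < m) ⊎ (∃[ j ] (1 ≤ j × j ≤ m + 1 × (r , t) ≡ qBlock j))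

  block-shape : ∀ {x} → x ∈ blocks → BlockShape x
  block-shape x∈ with ∈-++⁻ blocks₁ x∈
  ... | inj₁ x∈₁ with ∈-blocks₁⁻ x∈₁
  ...   | inj₁ (i , c , refl) = inj₁ (refl , xRadius<m _)
  ...   | inj₂ (i , refl) = inj₂ (_ , s≤s z≤n , i<n⇒tag≤ i , refl)
  block-shape x∈ | inj₂ x∈₂₃ with ∈-++⁻ blocks₂ x∈₂₃
  ... | inj₁ x∈₂ with ∈-blocks₂⁻ x∈₂
  ...   | inj₁ (r , r∈ , refl) = inj₁ (refl , proj₁ (∈-yRadii⁻ r∈))
  ...   | inj₂ (i , i<k , refl) = inj₂ (_ , ≤-trans (s≤s z≤n) (≤-reflexive (sym (+-suc n i))) , i<k⇒tag≤ i<k , refl)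
  block-shape x∈ | inj₂ _ | inj₂ x∈₃ =
    let (j , j∈ , e) = ∈-map⁻ qBlock x∈₃
        (n+k<j , j≤) = ∈-tailTags⁻ j∈
    in inj₂ (j , ≤-trans (s≤s z≤n) n+k<j , j≤ , e)

  tagged-radius : ∀ {r j} → (r , just j) ∈ blocks → r ≡ qRadius j
  tagged-radius x∈ with block-shape x∈
  ... | inj₂ (j , _ , _ , refl) = refl

  radius<2m+1 : ∀ {r} → r ∈ map proj₁ blocks → r < 2 * m + 1
  radius<2m+1 r∈ with ∈-map⁻ proj₁ r∈
  ... | x , x∈ , refl with block-shape x∈
  ...   | inj₁ (_ , r<m) = ≤-trans r<m (≤-trans (m≤m+n m _) (m≤m+n (2 * m) 1))
  ...   | inj₂ (j , 1≤j , _ , refl) = qRadius<2m+1 1≤j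

  radii : List Block → List ℕ
  radii = map proj₁

  ∈-radii₁⁻ : ∀ {r} → r ∈ radii blocks₁ → (∃[ s ] (r ≡ xRadius s)) ⊎ (∃[ j ] (j ≤ n × r ≡ qRadius j))
  ∈-radii₁⁻ r∈ with ∈-map⁻ proj₁ r∈
  ... | x , x∈ , refl with ∈-blocks₁⁻ x∈
  ...   | inj₁ (i , c , refl) = inj₁ (_ , refl)
  ...   | inj₂ (i , refl) = inj₂ (_ , Fin.toℕ<n i , refl)

  ∈-radii₂⁻ : ∀ {r} → r ∈ radii blocks₂ → (r ∈ yRadii) ⊎ (∃[ j ] (n < j × j ≤ n + k × r ≡ qRadius j))
  ∈-radii₂⁻ r∈ with ∈-map⁻ proj₁ r∈
  ... | x , x∈ , refl with ∈-blocks₂⁻ x∈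
  ...   | inj₁ (r , r∈ , refl) = inj₁ r∈
  ...   | inj₂ (i , i<k , refl) = inj₂ (_ , ≤-trans (s≤s (m≤m+n n i)) (≤-reflexive (sym (+-suc n i))) ,
                                         +-monoʳ-≤ n i<k , refl)

  ∈-radii₃⁻ : ∀ {r} → r ∈ radii blocks₃ → ∃[ j ] (n + k < j × j ≤ m + 1 × r ≡ qRadius j)
  ∈-radii₃⁻ r∈ with ∈-map⁻ proj₁ r∈
  ... | x , x∈ , refl = let (j , j∈ , e) = ∈-map⁻ qBlock x∈ in j , proj₁ (∈-tailTags⁻ j∈) , proj₂ (∈-tailTags⁻ j∈) , cong proj₁ e

  radii₁-apart-radii₂ : ∀ {r} → r ∈ radii blocks₁ → r ∈ radii blocks₂ → ⊥
  radii₁-apart-radii₂ r∈₁ r∈₂ with ∈-radii₁⁻ r∈₁ | ∈-radii₂⁻ r∈₂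
  ... | inj₁ (s , refl) | inj₁ r∈ = xRadius∉yRadii s r∈
  ... | inj₁ (s , refl) | inj₂ (j , _ , j≤ , e) = small≢qRadius (≤-trans j≤ n+k≤m+1) (xRadius<m s) e
  ... | inj₂ (j , j≤ , refl) | inj₁ r∈ = small≢qRadius (≤-trans j≤ n≤m+1) (proj₁ (∈-yRadii⁻ r∈)) refl
  ... | inj₂ (j , j≤ , refl) | inj₂ (j′ , n<j′ , j′≤ , e) = qRadius-apart j≤ n<j′ (≤-trans j′≤ n+k≤m+1) e

  radii₁-apart-radii₃ : ∀ {r} → r ∈ radii blocks₁ → r ∈ radii blocks₃ → ⊥
  radii₁-apart-radii₃ r∈₁ r∈₃ with ∈-radii₁⁻ r∈₁ | ∈-radii₃⁻ r∈₃
  ... | inj₁ (s , refl) | (j , _ , j≤ , e) = small≢qRadius j≤ (xRadius<m s) e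
  ... | inj₂ (j , j≤ , refl) | (j′ , n+k<j′ , j′≤ , e) = qRadius-apart (≤-trans j≤ (m≤m+n n k)) n+k<j′ j′≤ e

  radii₂-apart-radii₃ : ∀ {r} → r ∈ radii blocks₂ → r ∈ radii blocks₃ → ⊥
  radii₂-apart-radii₃ r∈₂ r∈₃ with ∈-radii₂⁻ r∈₂ | ∈-radii₃⁻ r∈₃
  ... | inj₁ r∈ | (j , _ , j≤ , e) = small≢qRadius j≤ (proj₁ (∈-yRadii⁻ r∈)) e
  ... | inj₂ (j , _ , j≤ , refl) | (j′ , n+k<j′ , j′≤ , e) = qRadius-apart j≤ n+k<j′ j′≤ e

  Unique-radii₁ : Unique (radii blocks₁)
  Unique-radii₁ = subst Unique (sym (List.map-concatMap proj₁ tripleBlocks (allFin n)))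
    (Unique-concatMap (λ i → radii (tripleBlocks i)) (allFin n) (allFin⁺ n) (λ {i} _ → unique i) (λ _ _ → apart))
    where
    xRadius≢ : ∀ {i c c′} → c ≢ c′ → xRadius (σ (i , c)) ≢ xRadius (σ (i , c′))
    xRadius≢ c≢c′ e = c≢c′ (cong proj₂ (σ-injective (xRadius-injective e)))

    xRadius≢qRadius : ∀ {i c} (i′ : Fin n) → xRadius (σ (i , c)) ≢ qRadius (suc (toℕ i′))
    xRadius≢qRadius i′ = small≢qRadius (i<n⇒tag≤ i′) (xRadius<m _)

    unique : ∀ i → Unique (radii (tripleBlocks i))
    unique i = (xRadius≢ (λ ()) ∷ xRadius≢ (λ ()) ∷ xRadius≢qRadius i ∷ [])
             ∷ (xRadius≢ (λ ()) ∷ xRadius≢qRadius i ∷ []) ∷ (xRadius≢qRadius i ∷ []) ∷ [] ∷ []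

    shape : ∀ {i r} → r ∈ radii (tripleBlocks i) → (∃[ c ] (r ≡ xRadius (σ (i , c)))) ⊎ (r ≡ qRadius (suc (toℕ i)))
    shape (here e) = inj₁ (_ , e)
    shape (there (here e)) = inj₁ (_ , e)
    shape (there (there (here e))) = inj₁ (_ , e)
    shape (there (there (there (here e)))) = inj₂ e

    apart : ∀ {i i′ r} → r ∈ radii (tripleBlocks i) → r ∈ radii (tripleBlocks i′) → i ≡ i′
    apart r∈ r∈′ with shape r∈ | shape r∈′
    ... | inj₁ (c , e) | inj₁ (c′ , e′) = cong proj₁ (σ-injective (xRadius-injective (trans (sym e) e′)))
    ... | inj₁ (c , e) | inj₂ e′ = ⊥-elim (xRadius≢qRadius _ (trans (sym e) e′))
    ... | inj₂ e | inj₁ (c′ , e′) = ⊥-elim (xRadius≢qRadius _ (trans (sym e′) e))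
    ... | inj₂ e | inj₂ e′ = Fin.toℕ-injective (suc-injective (qRadius-injective (i<n⇒tag≤ _) (i<n⇒tag≤ _) (trans (sym e) e′)))

  Unique-yRadii : Unique yRadii
  Unique-yRadii = Unique-reverse (filter⁺ (λ r → ¬? (oddNat r ∈? X')) (upTo⁺ m))

  Unique-radii₂ : Unique (radii blocks₂)
  Unique-radii₂ = subst Unique (sym (map-concat-zipWith proj₁ yBlocks (upTo k) yRadii))
    (Unique-concat-zipWith (λ i r → radii (yBlocks i r)) (upTo k) yRadii (upTo⁺ k) Unique-yRadii
      (λ i∈ r∈ → ((λ e → small≢qRadius (i<k⇒tag≤ (∈-upTo⁻ i∈)) (proj₁ (∈-yRadii⁻ r∈)) e) ∷ []) ∷ [] ∷ [])
      apart)
    where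
    apart : ∀ {i i′ r r′ x} → i ∈ upTo k → i′ ∈ upTo k → r ∈ yRadii → r′ ∈ yRadii →
      x ∈ radii (yBlocks i r) → x ∈ radii (yBlocks i′ r′) → i ≡ i′ ⊎ r ≡ r′
    apart _ _ _ _ (here e) (here e′) = inj₂ (trans (sym e) e′)
    apart _ i′∈ r∈ _ (here e) (there (here e′)) =
      ⊥-elim (small≢qRadius (i<k⇒tag≤ (∈-upTo⁻ i′∈)) (proj₁ (∈-yRadii⁻ r∈)) (trans (sym e) e′))
    apart i∈ _ _ r′∈ (there (here e)) (here e′) =
      ⊥-elim (small≢qRadius (i<k⇒tag≤ (∈-upTo⁻ i∈)) (proj₁ (∈-yRadii⁻ r′∈)) (trans (sym e′) e))
    apart i∈ i′∈ _ _ (there (here e)) (there (here e′)) =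
      inj₁ (suc-injective (+-cancelˡ-≡ n _ _ (qRadius-injective (i<k⇒tag≤ (∈-upTo⁻ i∈)) (i<k⇒tag≤ (∈-upTo⁻ i′∈)) (trans (sym e) e′))))

  Unique-radii₃ : Unique (radii blocks₃)
  Unique-radii₃ = subst Unique (List.map-∘ tailTags)
    (Unique-map-injectiveOn qRadius tailTags (map⁺ (λ e → suc-injective (+-cancelˡ-≡ (n + k) _ _ e)) (upTo⁺ _))
      λ j∈ j′∈ → qRadius-injective (proj₂ (∈-tailTags⁻ j∈)) (proj₂ (∈-tailTags⁻ j′∈)))

  Unique-radii : Unique (radii blocks)
  Unique-radii = subst Unique (sym (trans (List.map-++ proj₁ blocks₁ _) (cong (radii blocks₁ ++_) (List.map-++ proj₁ blocks₂ _))))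
    (++⁺ Unique-radii₁ (++⁺ Unique-radii₂ Unique-radii₃ λ (r∈₂ , r∈₃) → radii₂-apart-radii₃ r∈₂ r∈₃)
      λ (r∈₁ , r∈₂₃) → [ radii₁-apart-radii₂ r∈₁ , radii₁-apart-radii₃ r∈₁ ] (∈-++⁻ (radii blocks₂) r∈₂₃))

  -- zipWith truncates, so S′_1, …, S′_k all exist only because |Y| ≥ k.
  k≤length-yRadii : k ≤ length yRadii
  k≤length-yRadii = begin
    m ∸ 3 * n                                   ≤⟨ ∸-monoʳ-≤ m #inX′≤3n ⟩
    m ∸ length inX′                             ≡⟨ cong (_∸ length inX′) (sym (trans (length-filter-¬ inX′? (upTo m)) (List.length-upTo m))) ⟩
    length inX′ + length notInX′ ∸ length inX′  ≡⟨ m+n∸m≡n (length inX′) (length notInX′) ⟩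
    length notInX′                              ≡⟨ sym (List.length-reverse notInX′) ⟩
    length yRadii                               ∎
    where
    open ≤-Reasoning
    inX′? : Decidable (λ r → oddNat r ∈ X')
    inX′? r = oddNat r ∈? X'
    inX′ notInX′ : List ℕ
    inX′ = filter inX′? (upTo m)
    notInX′ = filter (λ r → ¬? (inX′? r)) (upTo m)
    #inX′≤3n : length inX′ ≤ 3 * n
    #inX′≤3n = begin
      length inX′              ≡⟨ sym (List.length-map oddNat inX′) ⟩
      length (map oddNat inX′) ≤⟨ Unique-⊆⇒length≤ (map oddNat inX′) X'
                                    (map⁺ (λ e → *-cancelˡ-≡ _ _ 2 (+-cancelʳ-≡ 1 _ _ e)) (filter⁺ inX′? (upTo⁺ m)))
                                    (λ r∈ → let (r , r∈inX′ , e) = ∈-map⁻ oddNat r∈ in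
                                            subst (_∈ X') (sym e) (proj₂ (∈-filter⁻ inX′? {xs = upTo m} r∈inX′))) ⟩
      length X'                ≡⟨ trans (List.length-map _ (Xlist n a)) length-X ⟩
      3 * n                    ∎

  #blocks≡2m+1 : length (radii blocks) ≡ 2 * m + 1
  #blocks≡2m+1 = begin
    length (radii blocks)                                ≡⟨ List.length-map proj₁ blocks ⟩
    length blocks                                        ≡⟨ List.length-++ blocks₁ ⟩
    length blocks₁ + length (blocks₂ ++ blocks₃)         ≡⟨ cong (length blocks₁ +_) (List.length-++ blocks₂) ⟩
    length blocks₁ + (length blocks₂ + length blocks₃)   ≡⟨ cong₂ (λ x y → x + (y + length blocks₃)) #blocks₁ #blocks₂ ⟩
    4 * n + (2 * k + length blocks₃)                     ≡⟨ cong (λ z → 4 * n + (2 * k + z)) #blocks₃ ⟩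
    4 * n + (2 * k + tail)                               ≡⟨ regroup n k tail ⟩
    (3 * n + k) + (n + k + tail)                         ≡⟨ cong₂ _+_ 3n+k≡m n+k+tail≡m+1 ⟩
    m + (m + 1)                                          ≡⟨ double m ⟩
    2 * m + 1                                            ∎
    where
    open ≡-Reasoning
    tail : ℕ
    tail = m + 1 ∸ (n + k)
    #blocks₁ : length blocks₁ ≡ 4 * n
    #blocks₁ = trans (length-concatMap tripleBlocks 4 (allFin n) (λ _ → refl)) (cong (4 *_) (List.length-tabulate {n = n} (λ x → x)))
    #blocks₂ : length blocks₂ ≡ 2 * k
    #blocks₂ = trans (length-concat-zipWith yBlocks 2 (upTo k) yRadii (λ _ _ → refl)
                        (subst (_≤ length yRadii) (sym (List.length-upTo k)) k≤length-yRadii))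
                     (cong (2 *_) (List.length-upTo k))
    #blocks₃ : length blocks₃ ≡ tail
    #blocks₃ = trans (List.length-map qBlock tailTags) (trans (List.length-map _ (upTo tail)) (List.length-upTo tail))
    regroup : ∀ n k t → 4 * n + (2 * k + t) ≡ (3 * n + k) + (n + k + t)
    regroup = solve-∀
    double : ∀ m → m + (m + 1) ≡ 2 * m + 1
    double = solve-∀

  square≤L : (2 * m + 1) * (2 * m + 1) ≤ L
  square≤L = subst (λ l → l * l ≤ L) #blocks≡2m+1
    (subst (length (radii blocks) * length (radii blocks) ≤_) (sym (trans L≡ (pathLength-oddSum blocks)))
      (length²≤oddSum (2 * m + 1) (radii blocks) Unique-radii (All.tabulate radius<2m+1)))

  Vertex : Set
  Vertex = V G

  offsetOfQ : ℕ → ℕ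
  offsetOfQ j = valueOf proj₁ (λ q → proj₁ (proj₂ q)) j Qs

  Q-offset-unique : ∀ {j o s o′ s′} → (j , o , s) ∈ Qs → (j , o′ , s′) ∈ Qs → o ≡ o′
  Q-offset-unique q∈ q∈′ with layout-place blocks 0 (subst (_ ∈_) Qs≡ q∈) | layout-place blocks 0 (subst (_ ∈_) Qs≡ q∈′)
  ... | (r , b∈ , _) | (r′ , b∈′ , _)
      with trans (tagged-radius (∈-place⇒∈ blocks 0 b∈)) (sym (tagged-radius (∈-place⇒∈ blocks 0 b∈′)))
  ...   | refl = proj₂ (place-radius-unique blocks 0 Unique-radii b∈ b∈′)

  offsetOfQ-∈ : ∀ {j o s} → (j , o , s) ∈ Qs → offsetOfQ j ≡ o
  offsetOfQ-∈ q∈ = valueOf-∈ proj₁ (λ q → proj₁ (proj₂ q)) Qs (λ { q∈′ refl → Q-offset-unique q∈′ q∈ }) q∈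

  -- Every vertex gets the position of a path vertex next to it; q_{jx} sits at w_x.
  position : GV → ℕ
  position (pv p) = p
  position (qv j x) = offsetOfQ j + x ∸ 1

  position-adj : ∀ {u v} → RAdj u v → Near 1 (position u) (position v)
  position-adj (path→ {p}) = ≤-trans (n≤1+n p) (n≤1+n _) , ≤-refl
  position-adj (path← {p}) = ≤-refl , ≤-trans (n≤1+n p) (n≤1+n _)
  position-adj (qw₁ q∈) rewrite offsetOfQ-∈ q∈ = Near-refl 1 _
  position-adj (qw₂ q∈) rewrite offsetOfQ-∈ q∈ = Near-pred _
  position-adj (wq₁ q∈) rewrite offsetOfQ-∈ q∈ = Near-refl 1 _
  position-adj (wq₂ q∈) rewrite offsetOfQ-∈ q∈ = Near-sym (Near-pred _)

  open LipschitzPosition G (λ v → position (proj₁ v)) position-adj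

  burning-length≥ : ∀ j (b : Fin j → Vertex) → IsBurningSeq G j b → 2 * m + 1 ≤ j
  burning-length≥ j b burn = ≮⇒≥ λ j<2m+1 → <-irrefl refl
    (<-≤-trans (*-mono-< j<2m+1 j<2m+1) (≤-trans square≤L (burning-covers≤square (λ p → pv (toℕ p) , Fin.toℕ<n p) (λ _ → refl) j b burn)))

  0<L : 0 < L
  0<L = <-≤-trans (s≤s z≤n) (subst (λ z → z * z ≤ L) (+-comm (2 * m) 1) square≤L)

  -- Positions outside the path are sent to its first vertex.
  pathVertex : ℕ → Vertex
  pathVertex p with p <? L
  ... | yes p<L = pv p , p<L
  ... | no _ = pv 0 , 0<L

  pathVertex-pv : ∀ {p} → p < L → proj₁ (pathVertex p) ≡ pv p
  pathVertex-pv {p} p<L with p <? L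
  ... | yes _ = refl
  ... | no p≮L = ⊥-elim (p≮L p<L)

  pathVertex-≡ : ∀ {p} (p<L : p < L) → pathVertex p ≡ (pv p , p<L)
  pathVertex-≡ {p} p<L with p <? L
  ... | yes p<L′ = cong (λ h → pv p , h) (<-irrelevant p<L′ p<L)
  ... | no p≮L = ⊥-elim (p≮L p<L)

  walk→ : ∀ c p → p + c < L → Dist≤ G c (pathVertex p) (pathVertex (p + c))
  walk→ zero p _ = subst (λ q → Dist≤ G 0 (pathVertex p) (pathVertex q)) (sym (+-identityʳ p)) here
  walk→ (suc c) p p+c<L =
    step (subst₂ RAdj (sym (pathVertex-pv (≤-<-trans (m≤m+n p (suc c)) p+c<L))) (sym (pathVertex-pv sp<L)) path→)
         (subst (λ q → Dist≤ G c (pathVertex (suc p)) (pathVertex q)) (sym (+-suc p c))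
                (walk→ c (suc p) (subst (_< L) (+-suc p c) p+c<L)))
    where sp<L : suc p < L
          sp<L = ≤-<-trans (subst (suc p ≤_) (sym (+-suc p c)) (s≤s (m≤m+n p c))) p+c<L

  walk← : ∀ c p → p + c < L → Dist≤ G c (pathVertex (p + c)) (pathVertex p)
  walk← zero p _ = subst (λ q → Dist≤ G 0 (pathVertex q) (pathVertex p)) (sym (+-identityʳ p)) here
  walk← (suc c) p p+c<L =
    step (subst₂ RAdj (sym (pathVertex-pv p+c<L)) (sym (pathVertex-pv p+c<L′)) (subst (λ q → RAdj q (pv (p + c))) (cong pv (sym (+-suc p c))) path←))
         (walk← c p p+c<L′)
    where p+c<L′ : p + c < L
          p+c<L′ = ≤-<-trans (+-monoʳ-≤ p (n≤1+n c)) p+c<L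

  path-Dist≤ : ∀ {d p q} → p < L → q < L → Near d p q → Dist≤ G d (pathVertex p) (pathVertex q)
  path-Dist≤ {d} {p} {q} p<L q<L (p≤ , q≤) with ≤-total p q
  ... | inj₁ p≤q = Dist≤-mono (m≤n+o⇒m∸n≤o q p (subst (q ≤_) (+-comm d p) q≤))
      (subst (λ z → Dist≤ G (q ∸ p) (pathVertex p) (pathVertex z)) (m+[n∸m]≡n p≤q) (walk→ (q ∸ p) p (subst (_< L) (sym (m+[n∸m]≡n p≤q)) q<L)))
  ... | inj₂ q≤p = Dist≤-mono (m≤n+o⇒m∸n≤o p q (subst (p ≤_) (+-comm d q) p≤))
      (subst (λ z → Dist≤ G (p ∸ q) (pathVertex z) (pathVertex q)) (m+[n∸m]≡n q≤p) (walk← (p ∸ q) q (subst (_< L) (sym (m+[n∸m]≡n q≤p)) p<L)))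

  offsetOfRadius : ℕ → ℕ
  offsetOfRadius r = valueOf proj₁ (λ b → proj₂ (proj₂ b)) r placed

  offsetOfRadius-∈ : ∀ {r t off} → (r , t , off) ∈ placed → offsetOfRadius r ≡ off
  offsetOfRadius-∈ b∈ = valueOf-∈ proj₁ (λ b → proj₂ (proj₂ b)) placed
    (λ { b∈′ refl → proj₂ (place-radius-unique blocks 0 Unique-radii b∈′ b∈) }) b∈

  block-in-path : ∀ {r t off} → (r , t , off) ∈ placed → off + (2 * r + 1) ≤ L
  block-in-path b∈ = subst (_ ≤_) (sym L≡) (place-within blocks 0 b∈)

  -- The block of radius r is lit at its centre at step 2m - r, leaving it exactly r rounds.
  burnOrder : Fin (2 * m + 1) → Vertex
  burnOrder i = pathVertex (offsetOfRadius r + r)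
    where r : ℕ
          r = 2 * m ∸ toℕ i

  reach-via-block : ∀ {r t off} → (r , t , off) ∈ placed → (v : Vertex) → Dist≤ G r v (pathVertex (off + r)) →
    ∃[ i ] Dist≤ G (2 * m + 1 ∸ suc (toℕ i)) v (burnOrder i)
  reach-via-block {r} b∈ v v⇝centre = i , subst₂ (λ d z → Dist≤ G d v (pathVertex z)) (sym rounds) (sym centre) v⇝centre
    where
    r≤2m : r ≤ 2 * m
    r≤2m = s≤s⁻¹ (subst (r <_) (+-comm (2 * m) 1) (radius<2m+1 (∈-map⁺ proj₁ (∈-place⇒∈ blocks 0 b∈))))
    index< : 2 * m ∸ r < 2 * m + 1
    index< = subst (2 * m ∸ r <_) (+-comm 1 (2 * m)) (s≤s (m∸n≤m (2 * m) r))
    i : Fin (2 * m + 1)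
    i = fromℕ< index<
    radius-i : 2 * m ∸ toℕ i ≡ r
    radius-i = trans (cong (2 * m ∸_) (Fin.toℕ-fromℕ< index<)) (m∸[m∸n]≡n r≤2m)
    rounds : 2 * m + 1 ∸ suc (toℕ i) ≡ r
    rounds = trans (cong (_∸ suc (toℕ i)) (+-comm (2 * m) 1)) radius-i
    centre : offsetOfRadius (2 * m ∸ toℕ i) + (2 * m ∸ toℕ i) ≡ _ + r
    centre = trans (cong (λ z → offsetOfRadius z + z) radius-i) (cong (_+ r) (offsetOfRadius-∈ b∈))

  path-vertex-near-centre : ∀ {p off r} → off ≤ p → p < off + (2 * r + 1) → Near r p (off + r)
  path-vertex-near-centre {p} {off} {r} off≤p p< =
    s≤s⁻¹ (subst (suc p ≤_) (regroup off r) p<) , subst (off + r ≤_) (+-comm p r) (+-monoˡ-≤ r off≤p)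
    where regroup : ∀ off r → off + (2 * r + 1) ≡ suc (r + (off + r))
          regroup = solve-∀

  r<2r+1 : ∀ r → r < 2 * r + 1
  r<2r+1 r = subst (r <_) (sym (regroup r)) (s≤s (m≤m+n r r))
    where regroup : ∀ r → 2 * r + 1 ≡ suc (r + r)
          regroup = solve-∀

  -- q_{jx} is adjacent to w_x and w_{x+1}; step to whichever of the two lies towards the centre w_{r+1}.
  q-vertex-reach : ∀ {j off x} r (q∈ : (j , off , 2 * r + 1) ∈ Qs) → 1 ≤ x → x < 2 * r + 1 →
    off + (2 * r + 1) ≤ L → (valid : Valid (qv j x)) → Dist≤ G r (qv j x , valid) (pathVertex (off + r))
  q-vertex-reach zero q∈ (s≤s z≤n) (s≤s ()) _
  q-vertex-reach {j} {off} {suc x} (suc r) q∈ _ x< in-path valid with suc x ≤? suc r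
  ... | yes x≤r = step (subst (RAdj (qv j (suc x))) (sym (pathVertex-pv w<L)) (qw₂ q∈))
                       (path-Dist≤ w<L centre<L (≤-trans (+-monoʳ-≤ off x≤r) (m≤n+m _ r) , centre≤))
    where
    w<L : off + suc x < L
    w<L = <-≤-trans (+-monoʳ-< off x<) in-path
    centre<L : off + suc r < L
    centre<L = <-≤-trans (+-monoʳ-< off (r<2r+1 (suc r))) in-path
    centre≤ : off + suc r ≤ r + (off + suc x)
    centre≤ = ≤-trans (+-monoʳ-≤ off (subst (suc r ≤_) (sym (+-suc r x)) (s≤s (m≤m+n r x)))) (≤-reflexive (+-lc off r (suc x)))
  ... | no x≰r = step (subst (RAdj (qv j (suc x))) (sym (pathVertex-pv w<L)) (qw₁ q∈))
                      (path-Dist≤ w<L centre<L (subst (λ w → Near r w (off + suc r)) (sym w≡) (w≤ , centre≤)))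
    where
    w≡ : off + suc x ∸ 1 ≡ off + x
    w≡ = cong (_∸ 1) (+-suc off x)
    w<L : off + suc x ∸ 1 < L
    w<L = ≤-<-trans (≤-reflexive w≡) (<-≤-trans (+-monoʳ-< off (<-trans (n<1+n x) x<)) in-path)
    centre<L : off + suc r < L
    centre<L = <-≤-trans (+-monoʳ-< off (r<2r+1 (suc r))) in-path
    x≤ : x ≤ r + suc r
    x≤ = s≤s⁻¹ (s≤s⁻¹ (subst (suc (suc x) ≤_) (regroup r) x<))
      where regroup : ∀ r → 2 * suc r + 1 ≡ suc (suc (r + suc r))
            regroup = solve-∀
    w≤ : off + x ≤ r + (off + suc r)
    w≤ = ≤-trans (+-monoʳ-≤ off x≤) (≤-reflexive (+-lc off r (suc r)))
    centre≤ : off + suc r ≤ r + (off + x)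
    centre≤ = ≤-trans (+-monoʳ-≤ off (s≤s⁻¹ (≰⇒> x≰r))) (m≤n+m _ r)

  burnOrder-burns : IsBurningSeq G (2 * m + 1) burnOrder
  burnOrder-burns (pv p , p<L) =
    let (r , t , off , b∈ , off≤p , p<) = block-containing blocks 0 p z≤n (subst (p <_) L≡ p<L)
    in reach-via-block b∈ _ (subst (λ v → Dist≤ G r v (pathVertex (off + r))) (pathVertex-≡ p<L)
         (path-Dist≤ p<L (<-≤-trans (+-monoʳ-< off (r<2r+1 r)) (block-in-path b∈)) (path-vertex-near-centre off≤p p<)))
  burnOrder-burns (qv j x , valid@(off , s , q∈ , 1≤x , x<s))
    with layout-place blocks 0 (subst ((j , off , s) ∈_) Qs≡ q∈)
  ... | r , b∈ , refl = reach-via-block b∈ _ (q-vertex-reach r q∈ 1≤x x<s (block-in-path b∈) valid)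

  burning-number : BurningNumber G (2 * m + 1)
  burning-number = (burnOrder , burnOrder-burns) , burning-length≥

lemma3 : (n B : ℕ) .{{_ : NonZero n}} (a : Fin (3 * n) → ℕ) →
    Injective _≡_ _≡_ a →
    sum (Xlist n a) ≡ n * B →
    (∀ i → B < 4 * a i × 2 * a i < B) →
    ThreePartition n B a →
    BurningNumber (Gp n a) (2 * maxX n a + 1)
lemma3 n B a a-injective sum-a a-bounds partition = GpBurning.burning-number n B a a-injective sum-a a-bounds partition
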